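{- Let $f$ be a quasi-polynomial with period $n$ and let $k$ be an integer. Then \[ \tilde f^{k}(t)=\tilde f^{\gcd(k,n)}(t). \] In particular, the quasi-polynomial $\tilde f^{k}$ has period $\gcd(k,n)$.
   Context: A quasi-polynomial is a function $f:\mathbb{Z}\to\mathbb{C}$ for which there exist a positive integer $N$ (a period) and polynomials $f_1,\dots,f_N$ (constituents) with $f(t)=f_j(t)$ for $t\equiv j\bmod N$; the minimal period is the least period. For $f$ with minimal period $N$ and constituents $f_j$ (indices mod $N$) and $m\in\mathbb{Z}$, $f^{\sigma^m}(t):=f_{j-m}(t)$ for $t\equiv j\bmod N$, and for $k\in\mathbb{Z}$, $\tilde f^{k}(t):=\frac{1}{N}\sum_{i=0}^{N-1}f^{\sigma^{ik}}(t)$. Here $n$ is any period of $f$ (not necessarily minimal). -}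

module Defs where

open import Level using (Level; _⊔_)
open import Algebra.Bundles using (CommutativeRing)
open import Data.Nat as ℕ using (ℕ; zero; suc; NonZero; _≤_)
open import Data.Integer as ℤ using (ℤ; +_; -[1+_])
open import Data.Integer.DivMod using (_%ℕ_)
open import Data.List using (List; []; _∷_)
open import Data.Product using (Σ; ∃; _×_)

module _ {c ℓ : Level} (R : CommutativeRing c ℓ) where
  open CommutativeRing R
  ιℕ : ℕ → Carrier
  ιℕ zero    = 0#
  ιℕ (suc m) = 1# + ιℕ m
  ιℤ : ℤ → Carrier
  ιℤ (+ m)     = ιℕ m
  ιℤ -[1+ m ]  = - ιℕ (suc m)

-- A commutative ring in which every positive integer is invertible
-- (a ℚ-algebra), e.g. ℂ.  Values of quasi-polynomials live here.
record QAlgebra (c ℓ : Level) : Set (Level.suc (c ⊔ ℓ)) where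
  field
    cring  : CommutativeRing c ℓ
    inv    : ℕ → CommutativeRing.Carrier cring
    inv-ιℕ : ∀ m → CommutativeRing._≈_ cring (CommutativeRing._*_ cring (inv (suc m)) (ιℕ cring (suc m))) (CommutativeRing.1# cring)
  open CommutativeRing cring public

module _ {c ℓ : Level} (A : QAlgebra c ℓ) where
  open QAlgebra A

  -- a polynomial, as its list of coefficients (constant term first)
  Poly : Set c
  Poly = List Carrier

  eval : Poly → ℤ → Carrier
  eval []       t = 0#
  eval (a ∷ as) t = a + ιℤ cring t * eval as t

  IsConstituents : (f : ℤ → Carrier) (N : ℕ) .{{_ : NonZero N}} → (ℕ → Poly) → Set ℓ
  IsConstituents f N p = ∀ t → f t ≈ eval (p (t %ℕ N)) t

  HasPeriod : (ℤ → Carrier) → ℕ → Set (c ⊔ ℓ)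
  HasPeriod f N = Σ (NonZero N) λ nz → ∃ λ (p : ℕ → Poly) → IsConstituents f N {{nz}} p

  IsMinimalPeriod : (ℤ → Carrier) → ℕ → Set (c ⊔ ℓ)
  IsMinimalPeriod f N = HasPeriod f N × (∀ M → HasPeriod f M → N ≤ M)

  sumTo : ℕ → (ℕ → Carrier) → Carrier
  sumTo zero    g = 0#
  sumTo (suc m) g = sumTo m g + g m

  -- f^{σ^m}(t) = f_{j-m}(t) for t ≡ j mod N, with N the minimal period and
  -- p the constituents for N
  σ-shift : (N : ℕ) .{{_ : NonZero N}} → (ℕ → Poly) → ℤ → ℤ → Carrier
  σ-shift N p m t = eval (p ((+ (t %ℕ N) ℤ.- m) %ℕ N)) t

  tilde : (N : ℕ) .{{_ : NonZero N}} → (ℕ → Poly) → ℤ → ℤ → Carrier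
  tilde N@(suc N′) p k t = inv N * sumTo N (λ i → σ-shift N p (+ i ℤ.* k) t)

module Submission where

-- Write t ≡ j mod N.  Then f̃ᵏ(t) is 1/N times the sum of the constituents
-- p_{j − ik}(t) over i < N, a sum over the orbit of j under translation by −k in
-- ℤ/N.  Such an orbit sum is unchanged by translations by gcd(k, N), which is a
-- multiple of k modulo N (Bézout), so averaging over them shows it only depends on
-- gcd(k, N).  The minimal period N divides the period n: by the Chinese remainder
-- theorem constituents for N and n of congruent indices modulo gcd(N, n) agree on
-- an arithmetic progression, hence everywhere since the ring is a ℚ-algebra, so
-- gcd(N, n) is a period.  Thus gcd(k, N) = gcd(gcd(k, n), N), giving
-- f̃ᵏ = f̃^{gcd(k,n)}; and since the orbit sum depends on t only modulo gcd(k, N),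
-- a divisor of gcd(k, n), that is a period.

open import Defs
open import Level using (Level)
open import Data.Nat as ℕ using (ℕ; zero; suc; NonZero)
import Data.Nat.Properties as ℕ
open import Data.Nat.DivMod using (_%_; _/_; m≡m%n+[m/n]*n; m<n⇒m%n≡m; [m+kn]%n≡m%n; %-distribˡ-+; %-distribˡ-*; %-remove-+ʳ)
open import Data.Nat.Divisibility as ℕ∣ using (divides; n∣m⇒m%n≡0; ∣-antisym; ∣m+n∣m⇒∣n; ∣m⇒∣m*n; ∣⇒≤; n∣m*n*o; m∣m*n)
open import Data.Nat.GCD using (gcd; gcd-GCD; gcd[m,n]≢0; gcd[m,n]∣m; gcd[m,n]∣n; gcd-greatest; gcd-assoc; module Bézout)
import Data.Nat.Tactic.RingSolver as ℕ-Solver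
open import Data.Integer as ℤ using (ℤ; +_; -[1+_]; ∣_∣; _%ℕ_; _/ℕ_)
import Data.Integer.Properties as ℤ
open import Data.Integer.DivMod using (n%ℕd<d; a≡a%ℕn+[a/ℕn]*n)
open import Data.Integer.Divisibility.Signed as ℤ∣ using (divides; ∣⇒∣ᵤ; ∣m∣n⇒∣m-n)
open import Data.Integer.Tactic.RingSolver using (solve-∀)
open import Data.List using ([]; _∷_; length)
open import Data.Product using (∃; _×_; _,_; proj₂)
open import Data.Sum using (inj₂)
open import Relation.Binary.PropositionalEquality as ≡ using (_≡_)

module _ where
  open import Data.Integer using (_+_; _-_; _*_; -_)

  %ℕ-unique : ∀ {r s} n .{{_ : NonZero n}} → r ℕ.< n → s ℕ.< n → + n ℤ∣.∣ + r - + s → r ≡ s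
  %ℕ-unique {r} {s} n r<n s<n n∣r-s =
    ℤ.+-injective (ℤ.i-j≡0⇒i≡j _ _ (ℤ.∣i∣≡0⇒i≡0 ∣r-s∣≡0))
    where
    ∣r-s∣<n : ∣ + r - + s ∣ ℕ.< n
    ∣r-s∣<n = ≡.subst (ℕ._< n) (≡.cong ∣_∣ (≡.sym (ℤ.m-n≡m⊖n r s)))
                (ℕ.≤-<-trans (ℤ.∣m⊝n∣≤m⊔n r s) (ℕ.⊔-lub r<n s<n))
    ∣r-s∣≡0 : ∣ + r - + s ∣ ≡ 0
    ∣r-s∣≡0 = ≡.trans (≡.sym (m<n⇒m%n≡m ∣r-s∣<n)) (n∣m⇒m%n≡0 _ n (∣⇒∣ᵤ n∣r-s))

  %ℕ-cong : ∀ x y n .{{_ : NonZero n}} → + n ℤ∣.∣ x - y → x %ℕ n ≡ y %ℕ n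
  %ℕ-cong x y n n∣x-y = %ℕ-unique n (n%ℕd<d x n) (n%ℕd<d y n) n∣r-s
    where
    r s q q′ : ℤ
    r = + (x %ℕ n)
    s = + (y %ℕ n)
    q = x /ℕ n
    q′ = y /ℕ n
    r-s≡ : r - s ≡ (x - y) - (q - q′) * + n
    r-s≡ = begin
      r - s                                              ≡⟨ rearrange r s q q′ (+ n) ⟩
      ((r + q * + n) - (s + q′ * + n)) - (q - q′) * + n  ≡⟨ ≡.cong₂ (λ a b → (a - b) - (q - q′) * + n)
                                                              (a≡a%ℕn+[a/ℕn]*n x n) (a≡a%ℕn+[a/ℕn]*n y n) ⟨
      (x - y) - (q - q′) * + n                           ∎
      where
      open ≡.≡-Reasoning
      rearrange : ∀ r s q q′ n → r - s ≡ ((r + q * n) - (s + q′ * n)) - (q - q′) * n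
      rearrange = solve-∀
    n∣r-s : + n ℤ∣.∣ r - s
    n∣r-s = ≡.subst (+ n ℤ∣.∣_) (≡.sym r-s≡) (∣m∣n⇒∣m-n n∣x-y (ℤ∣.∣n⇒∣m*n (q - q′) ℤ∣.∣-refl))

  [i+k*n]%ℕn≡i%ℕn : ∀ i k n .{{_ : NonZero n}} → (i + k * + n) %ℕ n ≡ i %ℕ n
  [i+k*n]%ℕn≡i%ℕn i k n = %ℕ-cong (i + k * + n) i n (divides k (cancel i (k * + n)))
    where
    cancel : ∀ i j → (i + j) - i ≡ j
    cancel = solve-∀

  m∣n⇒i%ℕn%m≡i%ℕm : ∀ {m n} i .{{_ : NonZero m}} .{{_ : NonZero n}} → m ℕ∣.∣ n → (i %ℕ n) % m ≡ i %ℕ m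
  m∣n⇒i%ℕn%m≡i%ℕm {m} {n} i (divides e ≡.refl) = ≡.sym (begin
    i %ℕ m                                        ≡⟨ ≡.cong (_%ℕ m) (a≡a%ℕn+[a/ℕn]*n i n) ⟩
    (+ (i %ℕ n) + (i /ℕ n) * + (e ℕ.* m)) %ℕ m    ≡⟨ ≡.cong (λ z → (+ (i %ℕ n) + z) %ℕ m) (reassoc (i /ℕ n)) ⟩
    (+ (i %ℕ n) + ((i /ℕ n) * + e) * + m) %ℕ m    ≡⟨ [i+k*n]%ℕn≡i%ℕn (+ (i %ℕ n)) ((i /ℕ n) * + e) m ⟩
    (i %ℕ n) % m                                  ∎)
    where
    open ≡.≡-Reasoning
    reassoc : ∀ q → q * + (e ℕ.* m) ≡ (q * + e) * + m
    reassoc q = ≡.trans (≡.cong (q *_) (ℤ.pos-* e m)) (≡.sym (ℤ.*-assoc q (+ e) (+ m)))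

  negMod : ℤ → ℕ → ℕ
  negMod (+ m)    N′ = m ℕ.* N′
  negMod -[1+ m ] N′ = suc m

  ∣-k-negMod : ∀ k N′ → + suc N′ ℤ∣.∣ - k - + negMod k N′
  ∣-k-negMod (+ m)    N′ = divides (- + m) (≡.trans (≡.cong (λ z → - + m - z) (ℤ.pos-* m N′)) (factor (+ m) (+ N′)))
    where
    factor : ∀ a b → - a - a * b ≡ - a * (+ 1 + b)
    factor = solve-∀
  ∣-k-negMod -[1+ m ] N′ = divides (+ 0) (ℤ.+-inverseʳ (+ suc m))

  [j-i*k]%ℕn≡[j+i*negMod]%n : ∀ j i k N′ → (+ j - + i * k) %ℕ suc N′ ≡ (j ℕ.+ i ℕ.* negMod k N′) % suc N′
  [j-i*k]%ℕn≡[j+i*negMod]%n j i k N′ =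
    %ℕ-cong (+ j - + i * k) (+ (j ℕ.+ i ℕ.* a)) (suc N′)
      (≡.subst (+ suc N′ ℤ∣.∣_) (≡.sym difference) (ℤ∣.∣n⇒∣m*n (+ i) (∣-k-negMod k N′)))
    where
    a : ℕ
    a = negMod k N′
    expand : ∀ j i k a → (j - i * k) - (j + i * a) ≡ i * (- k - a)
    expand = solve-∀
    difference : (+ j - + i * k) - + (j ℕ.+ i ℕ.* a) ≡ + i * (- k - + a)
    difference = ≡.trans (≡.cong (λ z → (+ j - + i * k) - z) (≡.trans (ℤ.pos-+ j (i ℕ.* a)) (≡.cong (_+_ (+ j)) (ℤ.pos-* i a))))
                       (expand (+ j) (+ i) k (+ a))

module _ where
  open import Data.Nat using (_+_; _*_)

  gcd[m*n,1+n]≡gcd[m,1+n] : ∀ m n → gcd (m * n) (suc n) ≡ gcd m (suc n)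
  gcd[m*n,1+n]≡gcd[m,1+n] m n = ∣-antisym
    (gcd-greatest d∣m (gcd[m,n]∣n (m * n) (suc n)))
    (gcd-greatest (∣m⇒∣m*n n (gcd[m,n]∣m m (suc n))) (gcd[m,n]∣n m (suc n)))
    where
    d : ℕ
    d = gcd (m * n) (suc n)
    d∣m*n+m : d ℕ∣.∣ m * n + m
    d∣m*n+m = ≡.subst (d ℕ∣.∣_) (≡.trans (ℕ.*-suc m n) (ℕ.+-comm m (m * n))) (ℕ∣.∣n⇒∣m*n m (gcd[m,n]∣n (m * n) (suc n)))
    d∣m : d ℕ∣.∣ m
    d∣m = ∣m+n∣m⇒∣n d∣m*n+m (gcd[m,n]∣m (m * n) (suc n))

  gcd-negMod : ∀ k N′ → gcd (negMod k N′) (suc N′) ≡ gcd ∣ k ∣ (suc N′)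
  gcd-negMod (+ m)    N′ = gcd[m*n,1+n]≡gcd[m,1+n] m N′
  gcd-negMod -[1+ m ] N′ = ≡.refl

  gcd[gcd[m,n],o]≡gcd[m,o] : ∀ m {n o} → o ℕ∣.∣ n → gcd (gcd m n) o ≡ gcd m o
  gcd[gcd[m,n],o]≡gcd[m,o] m {n} {o} o∣n =
    ≡.trans (gcd-assoc m n o) (≡.cong (gcd m) (∣-antisym (gcd[m,n]∣n n o) (gcd-greatest o∣n ℕ∣.∣-refl)))

  gcd-nonZeroʳ : ∀ m n .{{_ : NonZero n}} → NonZero (gcd m n)
  gcd-nonZeroʳ m n = ℕ.≢-nonZero (gcd[m,n]≢0 m n (inj₂ (ℕ.≢-nonZero⁻¹ n)))

  +-cong-mod : ∀ {a a′ b b′} n .{{_ : NonZero n}} → a % n ≡ a′ % n → b % n ≡ b′ % n → (a + b) % n ≡ (a′ + b′) % n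
  +-cong-mod {a} {a′} {b} {b′} n a≡a′ b≡b′ =
    ≡.trans (%-distribˡ-+ a b n) (≡.trans (≡.cong₂ (λ x y → (x + y) % n) a≡a′ b≡b′) (≡.sym (%-distribˡ-+ a′ b′ n)))

  *-congˡ-mod : ∀ l {b b′} n .{{_ : NonZero n}} → b % n ≡ b′ % n → (l * b) % n ≡ (l * b′) % n
  *-congˡ-mod l {b} {b′} n b≡b′ =
    ≡.trans (%-distribˡ-* l b n) (≡.trans (≡.cong (λ y → ((l % n) * y) % n) b≡b′) (≡.sym (%-distribˡ-* l b′ n)))

  gcd≡multiple-mod : ∀ a N .{{_ : NonZero N}} → ∃ λ u → (u * a) % N ≡ gcd a N % N
  gcd≡multiple-mod a N@(suc N′) with Bézout.identity (gcd-GCD a N)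
  ... | Bézout.+- x y eq = x , (begin
    (x * a) % N      ≡⟨ ≡.cong (_% N) (≡.sym eq) ⟩
    (d + y * N) % N  ≡⟨ [m+kn]%n≡m%n d y N ⟩
    d % N            ∎)
    where
    open ≡.≡-Reasoning
    d : ℕ
    d = gcd a N
  ... | Bézout.-+ x y eq = x * N′ , (begin  -- x N′ ≡ −x modulo N
    (x * N′ * a) % N                ≡⟨ [m+kn]%n≡m%n (x * N′ * a) y N ⟨
    (x * N′ * a + y * N) % N        ≡⟨ ≡.cong (λ z → (x * N′ * a + z) % N) eq ⟨
    (x * N′ * a + (d + x * a)) % N  ≡⟨ ≡.cong (_% N) (regroup x N′ a d) ⟩
    (d + (x * a) * N) % N           ≡⟨ [m+kn]%n≡m%n d (x * a) N ⟩
    d % N                           ∎)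
    where
    open ≡.≡-Reasoning
    d : ℕ
    d = gcd a N
    regroup : ∀ x N′ a d → x * N′ * a + (d + x * a) ≡ d + (x * a) * suc N′
    regroup = ℕ-Solver.solve-∀

  private
    crt-from-identity : ∀ M N {d} x y .{{_ : NonZero M}} .{{_ : NonZero N}} .{{_ : NonZero d}} →
      d + y * N ≡ x * M → ∀ {i j} → i % d ≡ j % d → ∃ λ u → u % M ≡ i % M × u % N ≡ j % N
    crt-from-identity M N@(suc N′) {d} x y eq {i} {j} i≡j = u , [m+kn]%n≡m%n i (x * e) M , u%N≡j%N
      where
      open ≡.≡-Reasoning
      r α β e u : ℕ
      r = i % d
      α = i / d
      β = j / d
      -- e ≡ β − α modulo N, since N′ ≡ −1.
      e = β + α * N′
      u = i + (x * e) * M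
      regroup₁ : ∀ i x e M → i + (x * e) * M ≡ i + e * (x * M)
      regroup₁ = ℕ-Solver.solve-∀
      regroup₂ : ∀ r α d β N′ y → (r + α * d) + (β + α * N′) * (d + y * suc N′)
                                  ≡ (r + β * d) + (α * d + y * (β + α * N′)) * suc N′
      regroup₂ = ℕ-Solver.solve-∀
      u≡j+kN : u ≡ j + (α * d + y * e) * N
      u≡j+kN = begin
        u                                      ≡⟨ regroup₁ i x e M ⟩
        i + e * (x * M)                        ≡⟨ ≡.cong₂ (λ a b → a + e * b) (m≡m%n+[m/n]*n i d) (≡.sym eq) ⟩
        (r + α * d) + e * (d + y * N)          ≡⟨ regroup₂ r α d β N′ y ⟩
        (r + β * d) + (α * d + y * e) * N      ≡⟨ ≡.cong (λ a → (a + β * d) + (α * d + y * e) * N) i≡j ⟩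
        (j % d + β * d) + (α * d + y * e) * N  ≡⟨ ≡.cong (λ a → a + (α * d + y * e) * N) (m≡m%n+[m/n]*n j d) ⟨
        j + (α * d + y * e) * N                ∎
      u%N≡j%N : u % N ≡ j % N
      u%N≡j%N = ≡.trans (≡.cong (_% N) u≡j+kN) ([m+kn]%n≡m%n j (α * d + y * e) N)

    crt-from-Bézout : ∀ M N {d} .{{_ : NonZero M}} .{{_ : NonZero N}} .{{_ : NonZero d}} →
      Bézout.Identity d M N → ∀ {i j} → i % d ≡ j % d → ∃ λ u → u % M ≡ i % M × u % N ≡ j % N
    crt-from-Bézout M N (Bézout.+- x y eq) i≡j = crt-from-identity M N x y eq i≡j
    crt-from-Bézout M N (Bézout.-+ x y eq) i≡j with crt-from-identity N M y x eq (≡.sym i≡j)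
    ... | u , u≡j , u≡i = u , u≡i , u≡j

  chinese-remainder : ∀ M N .{{_ : NonZero M}} .{{_ : NonZero N}} .{{_ : NonZero (gcd M N)}} {i j} →
    i % gcd M N ≡ j % gcd M N → ∃ λ u → u % M ≡ i % M × u % N ≡ j % N
  chinese-remainder M N = crt-from-Bézout M N (Bézout.identity (gcd-GCD M N))

module _ {c ℓ : Level} (A : QAlgebra c ℓ) where
  open QAlgebra A
  open import Relation.Binary.Reasoning.Setoid setoid
  open import Algebra.Solver.Ring.NaturalCoefficients.Default commutativeSemiring using (solve; _:+_; _:*_; _:=_)
  open import Algebra.Properties.Semiring.Mult semiring using (×-homo-+; ×1-homo-*) renaming (_×_ to _·_)
  open import Algebra.Properties.Ring ring using (-1*x≈-x)
  open import Algebra.Properties.Group +-group using (x∙y⁻¹≈ε⇒x≈y; x≈y⇒x∙y⁻¹≈ε; ∙-cancelʳ; \\-leftDividesˡ)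

  ι : ℕ → Carrier
  ι = ιℕ cring

  ι≡·1# : ∀ m → ι m ≡ m · 1#
  ι≡·1# zero    = ≡.refl
  ι≡·1# (suc m) = ≡.cong (_+_ 1#) (ι≡·1# m)

  ι-+ : ∀ m n → ι (m ℕ.+ n) ≈ ι m + ι n
  ι-+ m n = begin
    ι (m ℕ.+ n)         ≡⟨ ι≡·1# (m ℕ.+ n) ⟩
    (m ℕ.+ n) · 1#      ≈⟨ ×-homo-+ 1# m n ⟩
    m · 1# + n · 1#     ≡⟨ ≡.cong₂ _+_ (ι≡·1# m) (ι≡·1# n) ⟨
    ι m + ι n           ∎

  ι-* : ∀ m n → ι (m ℕ.* n) ≈ ι m * ι n
  ι-* m n = begin
    ι (m ℕ.* n)         ≡⟨ ι≡·1# (m ℕ.* n) ⟩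
    (m ℕ.* n) · 1#      ≈⟨ ×1-homo-* m n ⟩
    (m · 1#) * (n · 1#) ≡⟨ ≡.cong₂ _*_ (ι≡·1# m) (ι≡·1# n) ⟨
    ι m * ι n           ∎

  inv*ι*x≈x : ∀ N .{{_ : NonZero N}} x → inv N * (ι N * x) ≈ x
  inv*ι*x≈x (suc N′) x = begin
    inv (suc N′) * (ι (suc N′) * x) ≈⟨ sym (*-assoc _ _ _) ⟩
    (inv (suc N′) * ι (suc N′)) * x ≈⟨ *-congʳ (inv-ιℕ N′) ⟩
    1# * x                          ≈⟨ *-identityˡ x ⟩
    x                               ∎

  ι-cancelˡ : ∀ N .{{_ : NonZero N}} {x y} → ι N * x ≈ ι N * y → x ≈ y
  ι-cancelˡ N {x} {y} eq = trans (sym (inv*ι*x≈x N x)) (trans (*-congˡ eq) (inv*ι*x≈x N y))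

  ⟦_⟧ : Poly A → Carrier → Carrier
  ⟦ []     ⟧ x = 0#
  ⟦ a ∷ as ⟧ x = a + x * ⟦ as ⟧ x

  eval≡⟦⟧ : ∀ P t → eval A P t ≡ ⟦ P ⟧ (ιℤ cring t)
  eval≡⟦⟧ []       t = ≡.refl
  eval≡⟦⟧ (a ∷ as) t = ≡.cong (λ v → a + ιℤ cring t * v) (eval≡⟦⟧ as t)

  ⟦⟧-cong : ∀ P {x y} → x ≈ y → ⟦ P ⟧ x ≈ ⟦ P ⟧ y
  ⟦⟧-cong []       x≈y = refl
  ⟦⟧-cong (a ∷ as) x≈y = +-congˡ (*-cong x≈y (⟦⟧-cong as x≈y))

  -- Synthetic division by X − c, see factor-theorem.
  quot : Carrier → Poly A → Poly A
  quot c []       = []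
  quot c (b ∷ bs) = ⟦ b ∷ bs ⟧ c ∷ quot c bs

  length-quot : ∀ c bs → length (quot c bs) ≡ length bs
  length-quot c []       = ≡.refl
  length-quot c (b ∷ bs) = ≡.cong suc (length-quot c bs)

  x*⟦P⟧x-expand : ∀ bs c d → (c + d) * ⟦ bs ⟧ (c + d) ≈ c * ⟦ bs ⟧ c + d * ⟦ quot c bs ⟧ (c + d)
  x*⟦P⟧x-expand []       c d = trans (zeroʳ _) (sym (trans (+-cong (zeroʳ c) (zeroʳ d)) (+-identityˡ 0#)))
  x*⟦P⟧x-expand (b ∷ bs) c d = begin
    (c + d) * (b + (c + d) * ⟦ bs ⟧ (c + d)) ≈⟨ *-congˡ (+-congˡ (x*⟦P⟧x-expand bs c d)) ⟩
    (c + d) * (b + (c * s + d * q))          ≈⟨ regroup c d b s q ⟩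
    c * (b + c * s) + d * ((b + c * s) + (c + d) * q) ∎
    where
    s = ⟦ bs ⟧ c
    q = ⟦ quot c bs ⟧ (c + d)
    regroup : ∀ c d b s q → (c + d) * (b + (c * s + d * q)) ≈ c * (b + c * s) + d * ((b + c * s) + (c + d) * q)
    regroup = solve 5 (λ c d b s q → (c :+ d) :* (b :+ (c :* s :+ d :* q)) := c :* (b :+ c :* s) :+ d :* ((b :+ c :* s) :+ (c :+ d) :* q)) refl

  factor-theorem : ∀ a as c d → ⟦ a ∷ as ⟧ (c + d) ≈ ⟦ a ∷ as ⟧ c + d * ⟦ quot c as ⟧ (c + d)
  factor-theorem a as c d = trans (+-congˡ (x*⟦P⟧x-expand as c d)) (sym (+-assoc _ _ _))

  factor-at-root : ∀ a as c → ⟦ a ∷ as ⟧ c ≈ 0# → ∀ d → ⟦ a ∷ as ⟧ (c + d) ≈ d * ⟦ quot c as ⟧ (c + d)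
  factor-at-root a as c root d = trans (factor-theorem a as c d) (trans (+-congʳ root) (+-identityˡ _))

  unit*y≈0⇒y≈0 : ∀ {w d y} → w * d ≈ 1# → d * y ≈ 0# → y ≈ 0#
  unit*y≈0⇒y≈0 {w} {d} {y} w*d≈1 d*y≈0 = begin
    y            ≈⟨ *-identityˡ y ⟨
    1# * y       ≈⟨ *-congʳ w*d≈1 ⟨
    (w * d) * y  ≈⟨ *-assoc w d y ⟩
    w * (d * y)  ≈⟨ *-congˡ d*y≈0 ⟩
    w * 0#       ≈⟨ zeroʳ w ⟩
    0#           ∎

  vanishing-on-progression : ∀ P a b → (∀ m → ∃ λ w → w * (b * ι (suc m)) ≈ 1#) →
    (∀ m → ⟦ P ⟧ (a + b * ι m) ≈ 0#) → ∀ x → ⟦ P ⟧ x ≈ 0#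
  vanishing-on-progression P = go (length P) P ≡.refl
    where
    go : ∀ L P → length P ≡ L → ∀ a b → (∀ m → ∃ λ w → w * (b * ι (suc m)) ≈ 1#) →
      (∀ m → ⟦ P ⟧ (a + b * ι m) ≈ 0#) → ∀ x → ⟦ P ⟧ x ≈ 0#
    go _       []          _   a b units P≈0 x = refl
    go (suc L) P@(a₀ ∷ as) len a b units P≈0 x = begin
      ⟦ P ⟧ x                           ≈⟨ ⟦⟧-cong P (\\-leftDividesˡ a x) ⟨
      ⟦ P ⟧ (a + (- a + x))             ≈⟨ factor-at-root a₀ as a Pa≈0 (- a + x) ⟩
      (- a + x) * ⟦ Q ⟧ (a + (- a + x)) ≈⟨ *-congˡ (Q≈0 _) ⟩
      (- a + x) * 0#                    ≈⟨ zeroʳ _ ⟩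
      0#                                ∎
      where
      Q : Poly A
      Q = quot a as
      Pa≈0 : ⟦ P ⟧ a ≈ 0#
      Pa≈0 = trans (⟦⟧-cong P (sym (trans (+-congˡ (zeroʳ b)) (+-identityʳ a)))) (P≈0 0)
      -- Q vanishes at a + b (m + 1) because P does there and b (m + 1) is a unit.
      Q≈0-shifted : ∀ m → ⟦ Q ⟧ ((a + b) + b * ι m) ≈ 0#
      Q≈0-shifted m = trans (⟦⟧-cong Q shift)
        (unit*y≈0⇒y≈0 (proj₂ (units m)) (trans (sym (factor-at-root a₀ as a Pa≈0 _)) (P≈0 (suc m))))
        where
        shift : (a + b) + b * ι m ≈ a + b * ι (suc m)
        shift = trans (+-assoc _ _ _) (+-congˡ (sym (trans (distribˡ b 1# (ι m)) (+-congʳ (*-identityʳ b)))))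
      Q≈0 : ∀ y → ⟦ Q ⟧ y ≈ 0#
      Q≈0 = go L Q (≡.trans (length-quot a as) (ℕ.suc-injective len)) (a + b) b units Q≈0-shifted

  infixl 6 _+ₚ_ _-ₚ_
  infixr 7 _·ₚ_

  _+ₚ_ : Poly A → Poly A → Poly A
  []       +ₚ Q        = Q
  (a ∷ as) +ₚ []       = a ∷ as
  (a ∷ as) +ₚ (b ∷ bs) = (a + b) ∷ (as +ₚ bs)

  _·ₚ_ : Carrier → Poly A → Poly A
  s ·ₚ []       = []
  s ·ₚ (a ∷ as) = (s * a) ∷ (s ·ₚ as)

  _-ₚ_ : Poly A → Poly A → Poly A
  P -ₚ Q = P +ₚ (- 1#) ·ₚ Q

  ∑ₚ : ℕ → (ℕ → Poly A) → Poly A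
  ∑ₚ zero    P = []
  ∑ₚ (suc m) P = ∑ₚ m P +ₚ P m

  ⟦⟧-+ₚ : ∀ P Q x → ⟦ P +ₚ Q ⟧ x ≈ ⟦ P ⟧ x + ⟦ Q ⟧ x
  ⟦⟧-+ₚ []       Q        x = sym (+-identityˡ _)
  ⟦⟧-+ₚ (a ∷ as) []       x = sym (+-identityʳ _)
  ⟦⟧-+ₚ (a ∷ as) (b ∷ bs) x = trans (+-congˡ (*-congˡ (⟦⟧-+ₚ as bs x))) (regroup a b x _ _)
    where
    regroup : ∀ a b x p q → (a + b) + x * (p + q) ≈ (a + x * p) + (b + x * q)
    regroup = solve 5 (λ a b x p q → (a :+ b) :+ x :* (p :+ q) := (a :+ x :* p) :+ (b :+ x :* q)) refl

  ⟦⟧-·ₚ : ∀ s P x → ⟦ s ·ₚ P ⟧ x ≈ s * ⟦ P ⟧ x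
  ⟦⟧-·ₚ s []       x = sym (zeroʳ s)
  ⟦⟧-·ₚ s (a ∷ as) x = trans (+-congˡ (*-congˡ (⟦⟧-·ₚ s as x))) (regroup s a x _)
    where
    regroup : ∀ s a x p → s * a + x * (s * p) ≈ s * (a + x * p)
    regroup = solve 4 (λ s a x p → s :* a :+ x :* (s :* p) := s :* (a :+ x :* p)) refl

  ⟦⟧-minusₚ : ∀ P Q x → ⟦ P -ₚ Q ⟧ x ≈ ⟦ P ⟧ x - ⟦ Q ⟧ x
  ⟦⟧-minusₚ P Q x = trans (⟦⟧-+ₚ P _ x) (+-congˡ (trans (⟦⟧-·ₚ (- 1#) Q x) (-1*x≈-x _)))

  ⟦⟧-∑ₚ : ∀ m P x → ⟦ ∑ₚ m P ⟧ x ≈ sumTo A m (λ i → ⟦ P i ⟧ x)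
  ⟦⟧-∑ₚ zero    P x = refl
  ⟦⟧-∑ₚ (suc m) P x = trans (⟦⟧-+ₚ (∑ₚ m P) (P m) x) (+-congʳ (⟦⟧-∑ₚ m P x))

  agreement-on-progression : ∀ P Q u M .{{_ : NonZero M}} →
    (∀ m → ⟦ P ⟧ (ι (u ℕ.+ M ℕ.* m)) ≈ ⟦ Q ⟧ (ι (u ℕ.+ M ℕ.* m))) → ∀ x → ⟦ P ⟧ x ≈ ⟦ Q ⟧ x
  agreement-on-progression P Q u M@(suc _) P≈Q x =
    x∙y⁻¹≈ε⇒x≈y _ _ (trans (sym (⟦⟧-minusₚ P Q x)) (vanishing-on-progression (P -ₚ Q) (ι u) (ι M) units P-Q≈0 x))
    where
    units : ∀ m → ∃ λ w → w * (ι M * ι (suc m)) ≈ 1#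
    units m = inv (M ℕ.* suc m) , trans (*-congˡ (sym (ι-* M (suc m)))) (inv-ιℕ _)
    P-Q≈0 : ∀ m → ⟦ P -ₚ Q ⟧ (ι u + ι M * ι m) ≈ 0#
    P-Q≈0 m = trans (⟦⟧-cong (P -ₚ Q) (sym (trans (ι-+ u _) (+-congˡ (ι-* M m)))))
                (trans (⟦⟧-minusₚ P Q _) (x≈y⇒x∙y⁻¹≈ε (P≈Q m)))

  private
    ∑ : ℕ → (ℕ → Carrier) → Carrier
    ∑ = sumTo A

  sum-cong : ∀ m {g h : ℕ → Carrier} → (∀ i → g i ≈ h i) → ∑ m g ≈ ∑ m h
  sum-cong zero    g≈h = refl
  sum-cong (suc m) g≈h = +-cong (sum-cong m g≈h) (g≈h m)

  sum-distrib-+ : ∀ m (g h : ℕ → Carrier) → ∑ m (λ i → g i + h i) ≈ ∑ m g + ∑ m h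
  sum-distrib-+ zero    g h = sym (+-identityˡ _)
  sum-distrib-+ (suc m) g h = trans (+-congʳ (sum-distrib-+ m g h)) (+-medial _ _ _ _)
    where
    +-medial : ∀ a b c d → (a + b) + (c + d) ≈ (a + c) + (b + d)
    +-medial = solve 4 (λ a b c d → (a :+ b) :+ (c :+ d) := (a :+ c) :+ (b :+ d)) refl

  sum-zero : ∀ m → ∑ m (λ _ → 0#) ≈ 0#
  sum-zero zero    = refl
  sum-zero (suc m) = trans (+-identityʳ _) (sum-zero m)

  sum-comm : ∀ m n (g : ℕ → ℕ → Carrier) → ∑ m (λ i → ∑ n (g i)) ≈ ∑ n (λ l → ∑ m (λ i → g i l))
  sum-comm zero    n g = sym (sum-zero n)
  sum-comm (suc m) n g = trans (+-congʳ (sum-comm m n g)) (sym (sum-distrib-+ n (λ l → ∑ m (λ i → g i l)) (g m)))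

  sum-const : ∀ m x → ∑ m (λ _ → x) ≈ ι m * x
  sum-const zero    x = sym (zeroˡ x)
  sum-const (suc m) x = begin
    ∑ m (λ _ → x) + x  ≈⟨ +-congʳ (sum-const m x) ⟩
    ι m * x + x        ≈⟨ +-comm _ x ⟩
    x + ι m * x        ≈⟨ +-congʳ (*-identityˡ x) ⟨
    1# * x + ι m * x   ≈⟨ distribʳ x 1# (ι m) ⟨
    (1# + ι m) * x     ∎

  sum-rotate : ∀ m (h : ℕ → Carrier) → h m ≈ h 0 → ∑ m (λ i → h (suc i)) ≈ ∑ m h
  sum-rotate m h hm≈h0 = ∙-cancelʳ (h 0) _ _ (begin
    ∑ m (λ i → h (suc i)) + h 0   ≈⟨ +-comm _ _ ⟩
    h 0 + ∑ m (λ i → h (suc i))   ≈⟨ sum-unconsˡ m h ⟨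
    ∑ m h + h m                   ≈⟨ +-congˡ hm≈h0 ⟩
    ∑ m h + h 0                   ∎)
    where
    sum-unconsˡ : ∀ m (h : ℕ → Carrier) → ∑ (suc m) h ≈ h 0 + ∑ m (λ i → h (suc i))
    sum-unconsˡ zero    h = +-comm _ _
    sum-unconsˡ (suc m) h = trans (+-congʳ (sum-unconsˡ m h)) (+-assoc _ _ _)

  module OrbitSum (N : ℕ) .{{_ : NonZero N}} (F : ℕ → Carrier)
                  (F-cong : ∀ {x y} → x % N ≡ y % N → F x ≈ F y) where

    orbitSum : ℕ → ℕ → Carrier
    orbitSum a x = ∑ N (λ l → F (x ℕ.+ l ℕ.* a))

    orbitSum-cong : ∀ a {x y} → x % N ≡ y % N → orbitSum a x ≈ orbitSum a y
    orbitSum-cong a x≡y = sum-cong N (λ l → F-cong (+-cong-mod N x≡y ≡.refl))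

    orbitSum-+a : ∀ a x → orbitSum a (x ℕ.+ a) ≈ orbitSum a x
    orbitSum-+a a x = trans (sum-cong N (λ l → reflexive (≡.cong F (ℕ.+-assoc x a (l ℕ.* a)))))
                            (sum-rotate N (λ l → F (x ℕ.+ l ℕ.* a)) (F-cong x+Na≡x))
      where
      x+Na≡x : (x ℕ.+ N ℕ.* a) % N ≡ (x ℕ.+ 0) % N
      x+Na≡x = ≡.trans (≡.cong (λ z → (x ℕ.+ z) % N) (ℕ.*-comm N a))
                 (≡.trans ([m+kn]%n≡m%n x a N) (≡.cong (_% N) (≡.sym (ℕ.+-identityʳ x))))

    orbitSum-periodic : ∀ a x k → orbitSum a (x ℕ.+ k ℕ.* a) ≈ orbitSum a x
    orbitSum-periodic a x zero    = reflexive (≡.cong (orbitSum a) (ℕ.+-identityʳ x))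
    orbitSum-periodic a x (suc k) = begin
      orbitSum a (x ℕ.+ (a ℕ.+ k ℕ.* a)) ≡⟨ ≡.cong (orbitSum a) (regroup x a (k ℕ.* a)) ⟩
      orbitSum a ((x ℕ.+ k ℕ.* a) ℕ.+ a) ≈⟨ orbitSum-+a a (x ℕ.+ k ℕ.* a) ⟩
      orbitSum a (x ℕ.+ k ℕ.* a)         ≈⟨ orbitSum-periodic a x k ⟩
      orbitSum a x                       ∎
      where
      regroup : ∀ x a b → x ℕ.+ (a ℕ.+ b) ≡ (x ℕ.+ b) ℕ.+ a
      regroup x a b = ≡.trans (≡.cong (x ℕ.+_) (ℕ.+-comm a b)) (≡.sym (ℕ.+-assoc x b a))

    orbitSum-% : ∀ a .{{_ : NonZero a}} x → orbitSum a x ≈ orbitSum a (x % a)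
    orbitSum-% a x = trans (reflexive (≡.cong (orbitSum a) (m≡m%n+[m/n]*n x a))) (orbitSum-periodic a (x % a) (x / a))

    -- Averaging over the N translates x + l gcd(a, N), each of which leaves orbitSum a unchanged,
    -- turns the double sum into N copies of orbitSum (gcd a N) x.
    orbitSum-gcd : ∀ a x → orbitSum a x ≈ orbitSum (gcd a N) x
    orbitSum-gcd a x = ι-cancelˡ N (begin
      ι N * orbitSum a x                                     ≈⟨ sum-const N (orbitSum a x) ⟨
      ∑ N (λ _ → orbitSum a x)                               ≈⟨ sum-cong N (λ l → sym (translate-invariant l)) ⟩
      ∑ N (λ l → orbitSum a (x ℕ.+ l ℕ.* g))                 ≈⟨ sum-comm N N (λ l i → F ((x ℕ.+ l ℕ.* g) ℕ.+ i ℕ.* a)) ⟩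
      ∑ N (λ i → ∑ N (λ l → F ((x ℕ.+ l ℕ.* g) ℕ.+ i ℕ.* a))) ≈⟨ sum-cong N (λ i → sum-cong N (λ l → reflexive (≡.cong F (swap x (l ℕ.* g) (i ℕ.* a))))) ⟩
      ∑ N (λ i → orbitSum g (x ℕ.+ i ℕ.* a))                 ≈⟨ sum-cong N (λ i → multiple-of-g i) ⟩
      ∑ N (λ _ → orbitSum g x)                               ≈⟨ sum-const N (orbitSum g x) ⟩
      ι N * orbitSum g x                                     ∎)
      where
      g : ℕ
      g = gcd a N
      swap : ∀ x m n → (x ℕ.+ m) ℕ.+ n ≡ (x ℕ.+ n) ℕ.+ m
      swap x m n = ≡.trans (ℕ.+-assoc x m n) (≡.trans (≡.cong (x ℕ.+_) (ℕ.+-comm m n)) (≡.sym (ℕ.+-assoc x n m)))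
      multiple-of-g : ∀ i → orbitSum g (x ℕ.+ i ℕ.* a) ≈ orbitSum g x
      multiple-of-g i with gcd[m,n]∣m a N
      ... | divides a′ a≡a′g = trans (reflexive (≡.cong (λ z → orbitSum g (x ℕ.+ z))
                                       (≡.trans (≡.cong (i ℕ.*_) a≡a′g) (≡.sym (ℕ.*-assoc i a′ g)))))
                                     (orbitSum-periodic g x (i ℕ.* a′))
      translate-invariant : ∀ l → orbitSum a (x ℕ.+ l ℕ.* g) ≈ orbitSum a x
      translate-invariant l with gcd≡multiple-mod a N
      ... | u , ua≡g = trans (orbitSum-cong a (+-cong-mod {x} N ≡.refl lg≡lua)) (orbitSum-periodic a x (l ℕ.* u))
        where
        lg≡lua : (l ℕ.* g) % N ≡ (l ℕ.* u ℕ.* a) % N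
        lg≡lua = ≡.trans (*-congˡ-mod l N (≡.sym ua≡g)) (≡.cong (_% N) (≡.sym (ℕ.*-assoc l u a)))

module _ {c ℓ : Level} (A : QAlgebra c ℓ) (f : ℤ → QAlgebra.Carrier A) where
  open QAlgebra A
  open import Relation.Binary.Reasoning.Setoid setoid

  constituents-agree : ∀ M N p q .{{_ : NonZero M}} .{{_ : NonZero N}} .{{_ : NonZero (gcd M N)}} →
    IsConstituents A f M p → IsConstituents A f N q →
    ∀ {i j} → i % gcd M N ≡ j % gcd M N → ∀ x → ⟦ A ⟧ (p (i % M)) x ≈ ⟦ A ⟧ (q (j % N)) x
  constituents-agree M N p q hp hq {i} {j} i≡j with chinese-remainder M N i≡j
  ... | u , u≡i , u≡j = agreement-on-progression A (p (i % M)) (q (j % N)) u (M ℕ.* N) agree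
    where
    instance
      M*N≢0 : NonZero (M ℕ.* N)
      M*N≢0 = ℕ.m*n≢0 M N
    agree : ∀ m → ⟦ A ⟧ (p (i % M)) (ι A (u ℕ.+ M ℕ.* N ℕ.* m)) ≈ ⟦ A ⟧ (q (j % N)) (ι A (u ℕ.+ M ℕ.* N ℕ.* m))
    agree m = begin
      ⟦ A ⟧ (p (i % M)) (ι A t)   ≡⟨ eval≡⟦⟧ A (p (i % M)) (+ t) ⟨
      eval A (p (i % M)) (+ t)    ≡⟨ ≡.cong (λ r → eval A (p r) (+ t)) (≡.trans t≡u u≡i) ⟨
      eval A (p (t % M)) (+ t)    ≈⟨ hp (+ t) ⟨
      f (+ t)                     ≈⟨ hq (+ t) ⟩
      eval A (q (t % N)) (+ t)    ≡⟨ ≡.cong (λ r → eval A (q r) (+ t)) (≡.trans t≡u′ u≡j) ⟩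
      eval A (q (j % N)) (+ t)    ≡⟨ eval≡⟦⟧ A (q (j % N)) (+ t) ⟩
      ⟦ A ⟧ (q (j % N)) (ι A t)   ∎
      where
      t : ℕ
      t = u ℕ.+ M ℕ.* N ℕ.* m
      t≡u : t % M ≡ u % M
      t≡u = %-remove-+ʳ u (∣m⇒∣m*n m (m∣m*n N))
      t≡u′ : t % N ≡ u % N
      t≡u′ = %-remove-+ʳ u (n∣m*n*o M m)

  gcd-isConstituents : ∀ M N p q .{{_ : NonZero M}} .{{_ : NonZero N}} .{{_ : NonZero (gcd M N)}} →
    IsConstituents A f M p → IsConstituents A f N q → IsConstituents A f (gcd M N) p
  gcd-isConstituents M N p q hp hq t = begin
    f t                        ≈⟨ hp t ⟩
    eval A (p (t %ℕ M)) t      ≡⟨ eval≡⟦⟧ A (p _) t ⟩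
    ⟦ A ⟧ (p (t %ℕ M)) x       ≡⟨ ≡.cong (λ i → ⟦ A ⟧ (p i) x) (m<n⇒m%n≡m (n%ℕd<d t M)) ⟨
    ⟦ A ⟧ (p (t %ℕ M % M)) x   ≈⟨ p-agree (≡.trans (m∣n⇒i%ℕn%m≡i%ℕm t (gcd[m,n]∣m M N)) (≡.sym r%g≡r)) ⟩
    ⟦ A ⟧ (p (r % M)) x        ≡⟨ ≡.cong (λ i → ⟦ A ⟧ (p i) x) (m<n⇒m%n≡m (ℕ.<-≤-trans r<g (∣⇒≤ (gcd[m,n]∣m M N)))) ⟩
    ⟦ A ⟧ (p r) x              ≡⟨ eval≡⟦⟧ A (p _) t ⟨
    eval A (p r) t             ∎
    where
    x : Carrier
    x = ιℤ cring t
    r : ℕ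
    r = t %ℕ gcd M N
    r<g : r ℕ.< gcd M N
    r<g = n%ℕd<d t (gcd M N)
    r%g≡r : r % gcd M N ≡ r
    r%g≡r = m<n⇒m%n≡m r<g
    p-agree : ∀ {i j} → i % gcd M N ≡ j % gcd M N → ⟦ A ⟧ (p (i % M)) x ≈ ⟦ A ⟧ (p (j % M)) x
    p-agree {j = j} i≡j = trans (agree i≡j x) (sym (agree {j} ≡.refl x))
      where
      agree : ∀ {i j} → i % gcd M N ≡ j % gcd M N → ∀ y → ⟦ A ⟧ (p (i % M)) y ≈ ⟦ A ⟧ (q (j % N)) y
      agree = constituents-agree M N p q hp hq

  minimalPeriod∣period : ∀ {N n} p .{{_ : NonZero N}} → IsConstituents A f N p →
    (∀ M → HasPeriod A f M → N ℕ.≤ M) → HasPeriod A f n → N ℕ∣.∣ n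
  minimalPeriod∣period {N} {n} p hp minimal (n≢0 , q , hq) =
    ≡.subst (ℕ∣._∣ n) (ℕ.≤-antisym (∣⇒≤ (gcd[m,n]∣m N n)) (minimal (gcd N n) (g≢0 , p , gcd-isConstituents N n p q hp hq)))
      (gcd[m,n]∣n N n)
    where
    instance
      n≢0′ : NonZero n
      n≢0′ = n≢0
      g≢0 : NonZero (gcd N n)
      g≢0 = gcd-nonZeroʳ N n

module _ {c ℓ : Level} (A : QAlgebra c ℓ) (N′ : ℕ) (p : ℕ → Poly A) where
  open QAlgebra A
  open import Relation.Binary.Reasoning.Setoid setoid

  private
    N : ℕ
    N = suc N′
    F : ℤ → ℕ → Carrier
    F t x = eval A (p (x % N)) t
    module O t = OrbitSum A N (F t) (λ x≡y → reflexive (≡.cong (λ i → eval A (p i) t) x≡y))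
    open O using (orbitSum)

  orbitPoly : ℕ → ℕ → Poly A
  orbitPoly a r = ∑ₚ A N (λ l → p ((r ℕ.+ l ℕ.* a) % N))

  eval-·ₚ-orbitPoly : ∀ s a r t → eval A (_·ₚ_ A s (orbitPoly a r)) t ≈ s * orbitSum t a r
  eval-·ₚ-orbitPoly s a r t = begin
    eval A (_·ₚ_ A s (orbitPoly a r)) t                     ≡⟨ eval≡⟦⟧ A (_·ₚ_ A s (orbitPoly a r)) t ⟩
    ⟦ A ⟧ (_·ₚ_ A s (orbitPoly a r)) x                      ≈⟨ ⟦⟧-·ₚ A s (orbitPoly a r) x ⟩
    s * ⟦ A ⟧ (orbitPoly a r) x                             ≈⟨ *-congˡ (⟦⟧-∑ₚ A N _ x) ⟩
    s * sumTo A N (λ l → ⟦ A ⟧ (p ((r ℕ.+ l ℕ.* a) % N)) x) ≈⟨ *-congˡ (sum-cong A N (λ l → reflexive (eval≡⟦⟧ A (p ((r ℕ.+ l ℕ.* a) % N)) t))) ⟨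
    s * orbitSum t a r                                      ∎
    where
    x : Carrier
    x = ιℤ cring t

  orbitSum-negMod : ∀ t k x → orbitSum t (negMod k N′) x ≈ orbitSum t (gcd ∣ k ∣ N) x
  orbitSum-negMod t k x = trans (O.orbitSum-gcd t (negMod k N′) x)
                                (reflexive (≡.cong (λ a → orbitSum t a x) (gcd-negMod k N′)))

  tilde≈orbitSum : ∀ k t → tilde A N p k t ≈ inv N * orbitSum t (negMod k N′) (t %ℕ N)
  tilde≈orbitSum k t = *-congˡ (sum-cong A N (λ i → reflexive (≡.cong (λ r → eval A (p r) t)
                                  ([j-i*k]%ℕn≡[j+i*negMod]%n (t %ℕ N) i k N′))))

  tilde≈orbitSum-gcd : ∀ k t → tilde A N p k t ≈ inv N * orbitSum t (gcd ∣ k ∣ N) (t %ℕ N)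
  tilde≈orbitSum-gcd k t = trans (tilde≈orbitSum k t) (*-congˡ (orbitSum-negMod t k (t %ℕ N)))

  tilde-cong : ∀ k k′ → gcd ∣ k ∣ N ≡ gcd (∣ k′ ∣) N → ∀ t → tilde A N p k t ≈ tilde A N p k′ t
  tilde-cong k k′ eq t = begin
    tilde A N p k t                             ≈⟨ tilde≈orbitSum-gcd k t ⟩
    inv N * orbitSum t (gcd ∣ k ∣ N) (t %ℕ N)   ≡⟨ ≡.cong (λ a → inv N * orbitSum t a (t %ℕ N)) eq ⟩
    inv N * orbitSum t (gcd ∣ k′ ∣ N) (t %ℕ N)  ≈⟨ tilde≈orbitSum-gcd k′ t ⟨
    tilde A N p k′ t                            ∎

  tilde-hasPeriod : ∀ k M .{{_ : NonZero M}} → gcd ∣ k ∣ N ℕ∣.∣ M → HasPeriod A (tilde A N p k) M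
  tilde-hasPeriod k M@(suc _) g∣M = _ , Q , Q-isConstituents
    where
    a g : ℕ
    a = negMod k N′
    g = gcd ∣ k ∣ N
    instance
      g≢0 : NonZero g
      g≢0 = gcd-nonZeroʳ ∣ k ∣ N
    Q : ℕ → Poly A
    Q r = _·ₚ_ A (inv N) (orbitPoly a r)
    Q-isConstituents : IsConstituents A (tilde A N p k) M Q
    Q-isConstituents t = begin
      tilde A N p k t                    ≈⟨ tilde≈orbitSum-gcd k t ⟩
      inv N * orbitSum t g (t %ℕ N)      ≈⟨ *-congˡ (O.orbitSum-% t g (t %ℕ N)) ⟩
      inv N * orbitSum t g (t %ℕ N % g)  ≡⟨ ≡.cong (λ y → inv N * orbitSum t g y)
                                              (≡.trans (m∣n⇒i%ℕn%m≡i%ℕm t (gcd[m,n]∣n ∣ k ∣ N))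
                                                       (≡.sym (m∣n⇒i%ℕn%m≡i%ℕm t g∣M))) ⟩
      inv N * orbitSum t g (t %ℕ M % g)  ≈⟨ *-congˡ (O.orbitSum-% t g (t %ℕ M)) ⟨
      inv N * orbitSum t g (t %ℕ M)      ≈⟨ *-congˡ (orbitSum-negMod t k (t %ℕ M)) ⟨
      inv N * orbitSum t a (t %ℕ M)      ≈⟨ eval-·ₚ-orbitPoly (inv N) a (t %ℕ M) t ⟨
      eval A (Q (t %ℕ M)) t              ∎

proposition2p10 : {c ℓ : Level} (A : QAlgebra c ℓ) (f : ℤ → QAlgebra.Carrier A)
    (n : ℕ) → HasPeriod A f n →
    (N : ℕ) .{{_ : NonZero N}} → IsMinimalPeriod A f N →
    (p : ℕ → Poly A) → IsConstituents A f N p →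
    (k : ℤ) →
    (∀ t → QAlgebra._≈_ A (tilde A N p k t) (tilde A N p (+ gcd ∣ k ∣ n) t))
    × HasPeriod A (tilde A N p k) (gcd ∣ k ∣ n)
proposition2p10 A f n n-period@(n≢0 , _) N@(suc N′) (_ , minimal) p hp k =
  tilde-cong A N′ p k (+ g) (≡.sym gcd[g,N]≡gcd[k,N]) , tilde-hasPeriod A N′ p k g gcd[k,N]∣g
  where
  g : ℕ
  g = gcd ∣ k ∣ n
  instance
    n≢0′ : NonZero n
    n≢0′ = n≢0
    g≢0 : NonZero g
    g≢0 = gcd-nonZeroʳ ∣ k ∣ n
  gcd[g,N]≡gcd[k,N] : gcd g N ≡ gcd ∣ k ∣ N
  gcd[g,N]≡gcd[k,N] = gcd[gcd[m,n],o]≡gcd[m,o] ∣ k ∣ (minimalPeriod∣period A f p hp minimal n-period)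
  gcd[k,N]∣g : gcd ∣ k ∣ N ℕ∣.∣ g
  gcd[k,N]∣g = ≡.subst (ℕ∣._∣ g) gcd[g,N]≡gcd[k,N] (gcd[m,n]∣m g N)
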